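{- Let $n$ be a positive integer. Every $x\in V_{B_n}$ is the root of a reversed binary tree of depth $1$, and $x$ has exactly one child in this tree.
   Context: $\mathbf{F}_{2^n}$ is the field with $2^n$ elements, $\mathbf{P}^1(\mathbf{F}_{2^n})=\mathbf{F}_{2^n}\cup\{\infty\}$, and $\theta$ is the map on $\mathbf{P}^1(\mathbf{F}_{2^n})$ with $\theta(0)=\theta(\infty)=\infty$ and $\theta(\alpha)=\alpha+\alpha^{ -1}$ otherwise. With $\operatorname{Tr}_n(\beta)=\sum_{i=0}^{n-1}\beta^{2^i}$, let $B_n=\{\alpha\in\mathbf{F}_{2^n}^*:\operatorname{Tr}_n(\alpha)\neq\operatorname{Tr}_n(\alpha^{ -1})\}$; $\theta(B_n)\subseteq B_n$. An element $z$ is periodic if $\theta^k(z)=z$ for some $k\ge1$, and $V_{B_n}$ is the set of periodic elements of $B_n$. For periodic $x$, the reversed tree rooted at $x$ consists of $x$ (level $0$) together with all non-periodic $z$ such that $\theta^k(z)=x$ for some $k\ge1$ and $\theta^i(z)$ is non-periodic for all $i<k$; such $z$ is at level $k$. The children of a vertex $u$ are the non-periodic $z$ with $\theta(z)=u$; the depth of the tree is its maximal level. -}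

module Defs where

open import Level using (0ℓ)
open import Data.Nat using (ℕ; zero; suc; _^_; _<_; _≤_; _≥_)
open import Data.Fin using (Fin)
open import Data.Maybe using (Maybe; just; nothing)
open import Data.Product using (Σ; ∃; _×_; _,_)
open import Relation.Nullary using (¬_; Dec; yes; no)
open import Relation.Binary.PropositionalEquality using (_≡_; _≢_)
open import Function.Bundles using (_↔_)
open import Function using (id)
import Algebra.Structures as AS

-- A model of the field F_{2^n}: a field (with propositional equality) of
-- characteristic 2 (encoded by negation being the identity, so x + x ≡ 0)
-- having exactly 2^n elements.  Any two such are isomorphic, so quantifying
-- over all of them is the same as talking about "the" field F_{2^n}.
record F2^ (n : ℕ) : Set₁ where
  infixl 6 _+_
  infixl 7 _*_
  field
    Carrier : Set
    _+_ _*_ : Carrier → Carrier → Carrier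
    0# 1#   : Carrier
    _⁻¹     : Carrier → Carrier
    isCommutativeRing :
      AS.IsCommutativeRing {A = Carrier} _≡_ _+_ _*_ id 0# 1#
    1≢0     : 1# ≢ 0#
    inverse : ∀ x → x ≢ 0# → x * (x ⁻¹) ≡ 1#
    _≟_     : (x y : Carrier) → Dec (x ≡ y)
    card    : Carrier ↔ Fin (2 ^ n)

module _ {n : ℕ} (F : F2^ n) where
  open F2^ F

  sq^ : ℕ → Carrier → Carrier
  sq^ zero    x = x
  sq^ (suc i) x = let y = sq^ i x in y * y

  trSum : ℕ → Carrier → Carrier
  trSum zero    x = 0#
  trSum (suc k) x = trSum k x + sq^ k x

  Tr : Carrier → Carrier
  Tr = trSum n

  InB : Carrier → Set
  InB α = (α ≢ 0#) × (Tr α ≢ Tr (α ⁻¹))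

  -- P^1(F_{2^n}) = F_{2^n} ∪ {∞}, with nothing = ∞
  P1 : Set
  P1 = Maybe Carrier

  θ : P1 → P1
  θ nothing  = nothing
  θ (just α) with α ≟ 0#
  ... | yes _ = nothing
  ... | no  _ = just (α + α ⁻¹)

  θ^ : ℕ → P1 → P1
  θ^ zero    z = z
  θ^ (suc k) z = θ (θ^ k z)

  Periodic : P1 → Set
  Periodic z = Σ ℕ λ k → (k ≥ 1) × (θ^ k z ≡ z)

  InVB : Carrier → Set
  InVB x = InB x × Periodic (just x)

  -- z is a vertex at level k ≥ 1 of the reversed tree rooted at (periodic) r
  AtLevel : P1 → P1 → ℕ → Set
  AtLevel r z k = (k ≥ 1) × (θ^ k z ≡ r) × (∀ i → i < k → ¬ Periodic (θ^ i z))

  ChildOf : P1 → P1 → Set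
  ChildOf z u = ¬ Periodic z × (θ z ≡ u)

module Submission where

-- The argument is arithmetic in F = F_{2^n}, driven by the trace Tr.
--  * Fermat:  a^{2^n} = a, by comparing the products of all nonzero
--    elements before and after multiplying them by a ≠ 0.  Hence Tr(a²) = Tr(a),
--    so Tr(t² + t) = 0 for every t.
--  * If β = u + u⁻¹ ≠ 0 then β⁻² = t² + t for t = u β⁻¹, hence Tr(β⁻¹) = 0:
--    every nonzero finite value b of θ satisfies Tr(b⁻¹) = 0.  Periodic points
--    are values of θ, so they all have this property.
--  * The fibre of θ over α + α⁻¹ is {α, α⁻¹}.
-- For periodic x ∈ B_n let y be its periodic predecessor.  Then Tr(x) ≠ 0 and
-- Tr(y) = Tr(y + y⁻¹) = Tr(x), so Tr((y⁻¹)⁻¹) ≠ 0.  Consequently y⁻¹ is not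
-- periodic (it is the unique child of x), and y⁻¹ is not a value of θ at all
-- (so no vertex lies at level 2 or deeper).

open import Level using (0ℓ)
open import Defs
open import Data.Nat using (ℕ; zero; suc; _^_; _≤_; _<_; _≥_; z≤n; s≤s)
import Data.Nat as Nat
import Data.Nat.Properties as Natₚ
open import Data.Maybe using (just; nothing)
open import Data.Product using (Σ; _×_; _,_; proj₁; proj₂)
open import Data.Fin using (Fin; punchIn) renaming (zero to fzero; suc to fsuc)
open import Data.Fin.Properties using (punchInᵢ≢i)
open import Data.Fin.Permutation using (Permutation; permutation)
open import Data.Empty using (⊥-elim)
open import Data.Sum using (_⊎_; inj₁; inj₂)
open import Relation.Nullary using (¬_; yes; no)
open import Relation.Binary.PropositionalEquality
open import Function using (id; _∘_)
open import Function.Bundles using (Inverse)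
open import Algebra.Bundles using (CommutativeRing; Semiring)
import Algebra.Properties.Group as GroupProperties
import Algebra.Properties.CommutativeSemigroup as CommutativeSemigroupProperties
import Algebra.Properties.CommutativeMonoid.Sum as ProductProperties
import Algebra.Definitions.RawSemiring as SemiringDefinitions
import Algebra.Properties.Semiring.Exp as ExpProperties

-- Arithmetic in a field of characteristic two.
module FieldFacts {n : ℕ} (F : F2^ n) where
  open F2^ F
  open ≡-Reasoning

  ring : CommutativeRing 0ℓ 0ℓ
  ring = record
    { Carrier = Carrier ; _≈_ = _≡_ ; _+_ = _+_ ; _*_ = _*_ ; -_ = id
    ; 0# = 0# ; 1# = 1# ; isCommutativeRing = isCommutativeRing }

  open CommutativeRing ring public
    using ( +-assoc; +-comm; +-identityˡ; *-assoc; *-comm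
          ; *-identityˡ; *-identityʳ; distribˡ; distribʳ; zeroʳ
          ; semiring; *-commutativeMonoid )
  open GroupProperties (CommutativeRing.+-group ring)
    using (inverseˡ-unique; ∙-cancelʳ)
  open CommutativeSemigroupProperties (CommutativeRing.+-commutativeSemigroup ring)
    public using ()
    renaming (interchange to +-interchange; xy∙z≈x∙zy to +-rotate; xy∙z≈xz∙y to +-swapʳ)
  open CommutativeSemigroupProperties (CommutativeRing.*-commutativeSemigroup ring)
    public using () renaming (interchange to *-interchange)

  -- Negation is the identity, so every element is its own additive inverse.
  +-self : ∀ a → a + a ≡ 0#
  +-self = CommutativeRing.-‿inverseʳ ring

  +-self-cancel : ∀ a b → a + (a + b) ≡ b
  +-self-cancel a b = begin
    a + (a + b) ≡⟨ sym (+-assoc a a b) ⟩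
    (a + a) + b ≡⟨ cong (_+ b) (+-self a) ⟩
    0# + b      ≡⟨ +-identityˡ b ⟩
    b           ∎

  +≡0⇒≡ : ∀ {a b} → a + b ≡ 0# → a ≡ b
  +≡0⇒≡ {a} {b} = inverseˡ-unique a b

  +-cancelʳ : ∀ {a b} c → a + c ≡ b + c → a ≡ b
  +-cancelʳ c = ∙-cancelʳ c _ _

  square-+ : ∀ a b → (a + b) * (a + b) ≡ a * a + b * b
  square-+ a b = begin
    (a + b) * (a + b)                  ≡⟨ distribʳ (a + b) a b ⟩
    a * (a + b) + b * (a + b)          ≡⟨ cong₂ _+_ (distribˡ a a b) (distribˡ b a b) ⟩
    (a * a + a * b) + (b * a + b * b)  ≡⟨ cong (λ z → (a * a + a * b) + (z + b * b)) (*-comm b a) ⟩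
    (a * a + a * b) + (a * b + b * b)  ≡⟨ +-assoc (a * a) (a * b) _ ⟩
    a * a + (a * b + (a * b + b * b))  ≡⟨ cong (a * a +_) (+-self-cancel (a * b) (b * b)) ⟩
    a * a + b * b                      ∎

  inverseˡ : ∀ {a} → a ≢ 0# → a ⁻¹ * a ≡ 1#
  inverseˡ {a} a≢0 = trans (*-comm (a ⁻¹) a) (inverse a a≢0)

  ⁻¹-undoes-* : ∀ {a} → a ≢ 0# → ∀ b → a ⁻¹ * (a * b) ≡ b
  ⁻¹-undoes-* {a} a≢0 b = begin
    a ⁻¹ * (a * b) ≡⟨ sym (*-assoc (a ⁻¹) a b) ⟩
    (a ⁻¹ * a) * b ≡⟨ cong (_* b) (inverseˡ a≢0) ⟩
    1# * b         ≡⟨ *-identityˡ b ⟩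
    b              ∎

  *-undoes-⁻¹ : ∀ {a} → a ≢ 0# → ∀ b → a * (a ⁻¹ * b) ≡ b
  *-undoes-⁻¹ {a} a≢0 b = begin
    a * (a ⁻¹ * b) ≡⟨ sym (*-assoc a (a ⁻¹) b) ⟩
    (a * a ⁻¹) * b ≡⟨ cong (_* b) (inverse a a≢0) ⟩
    1# * b         ≡⟨ *-identityˡ b ⟩
    b              ∎

  *-cancelˡ : ∀ {a b c} → a ≢ 0# → a * b ≡ a * c → b ≡ c
  *-cancelˡ {a} {b} {c} a≢0 ab≡ac =
    trans (sym (⁻¹-undoes-* a≢0 b)) (trans (cong (a ⁻¹ *_) ab≡ac) (⁻¹-undoes-* a≢0 c))

  zero-product : ∀ {a b} → a ≢ 0# → a * b ≡ 0# → b ≡ 0#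
  zero-product {a} a≢0 ab≡0 = *-cancelˡ a≢0 (trans ab≡0 (sym (zeroʳ a)))

  *-nonzero : ∀ {a b} → a ≢ 0# → b ≢ 0# → a * b ≢ 0#
  *-nonzero a≢0 b≢0 ab≡0 = b≢0 (zero-product a≢0 ab≡0)

  ⁻¹-nonzero : ∀ {a} → a ≢ 0# → a ⁻¹ ≢ 0#
  ⁻¹-nonzero {a} a≢0 a⁻¹≡0 =
    1≢0 (trans (sym (inverse a a≢0)) (trans (cong (a *_) a⁻¹≡0) (zeroʳ a)))

  ⁻¹-involutive : ∀ {a} → a ≢ 0# → (a ⁻¹) ⁻¹ ≡ a
  ⁻¹-involutive {a} a≢0 =
    *-cancelˡ (⁻¹-nonzero a≢0) (trans (inverse (a ⁻¹) (⁻¹-nonzero a≢0)) (sym (inverseˡ a≢0)))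

  -- u (u + u⁻¹) = u² + 1: the identity behind the fibres of θ and Tr(θ(u)⁻¹) = 0.
  *-θ-value : ∀ {u} → u ≢ 0# → u * (u + u ⁻¹) ≡ u * u + 1#
  *-θ-value {u} u≢0 = trans (distribˡ u u (u ⁻¹)) (cong (u * u +_) (inverse u u≢0))

  -- The fibre of α ↦ α + α⁻¹ through y consists of y and y⁻¹, because
  -- (α + y)(α + y⁻¹) = α (α + (y + y⁻¹)) + 1 = α α⁻¹ + 1 = 0.
  same-θ-value : ∀ {α y} → y ≢ 0# → α ≢ 0# → α + α ⁻¹ ≡ y + y ⁻¹ → (α ≡ y) ⊎ (α ≡ y ⁻¹)
  same-θ-value {α} {y} y≢0 α≢0 same with (α + y) ≟ 0#
  ... | yes α+y≡0 = inj₁ (+≡0⇒≡ α+y≡0)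
  ... | no  α+y≢0 = inj₂ (+≡0⇒≡ (zero-product α+y≢0 product≡0))
    where
    product≡0 : (α + y) * (α + y ⁻¹) ≡ 0#
    product≡0 = begin
      (α + y) * (α + y ⁻¹)                 ≡⟨ distribʳ (α + y ⁻¹) α y ⟩
      α * (α + y ⁻¹) + y * (α + y ⁻¹)      ≡⟨ cong (α * (α + y ⁻¹) +_) (distribˡ y α (y ⁻¹)) ⟩
      α * (α + y ⁻¹) + (y * α + y * y ⁻¹)  ≡⟨ cong₂ (λ p q → α * (α + y ⁻¹) + (p + q)) (*-comm y α) (inverse y y≢0) ⟩
      α * (α + y ⁻¹) + (α * y + 1#)        ≡⟨ sym (+-assoc _ (α * y) 1#) ⟩
      (α * (α + y ⁻¹) + α * y) + 1#        ≡⟨ cong (_+ 1#) (sym (distribˡ α (α + y ⁻¹) y)) ⟩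
      α * ((α + y ⁻¹) + y) + 1#            ≡⟨ cong (λ z → α * z + 1#) (+-rotate α (y ⁻¹) y) ⟩
      α * (α + (y + y ⁻¹)) + 1#            ≡⟨ cong (λ z → α * (α + z) + 1#) (sym same) ⟩
      α * (α + (α + α ⁻¹)) + 1#            ≡⟨ cong (λ z → α * z + 1#) (+-self-cancel α (α ⁻¹)) ⟩
      α * α ⁻¹ + 1#                        ≡⟨ cong (_+ 1#) (inverse α α≢0) ⟩
      1# + 1#                              ≡⟨ +-self 1# ⟩
      0#                                   ∎

-- Fermat's little theorem for F: every a satisfies a^{2^n} = a.
module Fermat {n : ℕ} (F : F2^ n) where
  open F2^ F
  open FieldFacts F
  open ≡-Reasoning
  open SemiringDefinitions (Semiring.rawSemiring semiring) using () renaming (_^_ to _^ᶠ_)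
  open ExpProperties semiring using (^-homo-*; ^-congʳ)
  module Π = ProductProperties *-commutativeMonoid

  prod-nonzero : ∀ {m} (f : Fin m → Carrier) → (∀ i → f i ≢ 0#) → Π.sum f ≢ 0#
  prod-nonzero {zero}  f nonzero = 1≢0
  prod-nonzero {suc m} f nonzero =
    *-nonzero (nonzero fzero) (prod-nonzero (f ∘ fsuc) (nonzero ∘ fsuc))

  prod-single : ∀ {m} (f : Fin m → Carrier) i₀ → (∀ j → j ≢ i₀ → f j ≡ 1#) → Π.sum f ≡ f i₀
  prod-single {suc m} f i₀ others = begin
    Π.sum f                                ≡⟨ Π.sum-remove {i = i₀} f ⟩
    f i₀ * Π.sum (λ j → f (punchIn i₀ j))  ≡⟨ cong (f i₀ *_) rest≡1 ⟩
    f i₀ * 1#                              ≡⟨ *-identityʳ (f i₀) ⟩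
    f i₀                                   ∎
    where
    rest≡1 : Π.sum (λ j → f (punchIn i₀ j)) ≡ 1#
    rest≡1 = trans (Π.sum-cong-≋ (λ j → others _ (punchInᵢ≢i i₀ j))) (Π.sum-replicate-zero m)

  N : ℕ
  N = 2 ^ n

  to : Carrier → Fin N
  to = Inverse.to card

  from : Fin N → Carrier
  from = Inverse.from card

  ∏ : (Carrier → Carrier) → Carrier
  ∏ f = Π.sum (f ∘ from)

  ∏-cong : ∀ {f g} → (∀ c → f c ≡ g c) → ∏ f ≡ ∏ g
  ∏-cong f≗g = Π.sum-cong-≋ (f≗g ∘ from)

  ∏-mul : ∀ f g → ∏ (λ c → f c * g c) ≡ ∏ f * ∏ g
  ∏-mul f g = Π.∑-distrib-+ (f ∘ from) (g ∘ from)

  ∏-const : ∀ a → ∏ (λ _ → a) ≡ a ^ᶠ N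
  ∏-const a = Π.sum-replicate N

  ∏-nonzero : ∀ f → (∀ c → f c ≢ 0#) → ∏ f ≢ 0#
  ∏-nonzero f nonzero = prod-nonzero (f ∘ from) (nonzero ∘ from)

  ∏-single : ∀ f c₀ → (∀ c → c ≢ c₀ → f c ≡ 1#) → ∏ f ≡ f c₀
  ∏-single f c₀ others =
    trans (prod-single (f ∘ from) (to c₀) other-indices) (cong f (Inverse.strictlyInverseʳ card c₀))
    where
    other-indices : ∀ j → j ≢ to c₀ → f (from j) ≡ 1#
    other-indices j j≢ = others (from j) (λ e → j≢ (trans (sym (Inverse.strictlyInverseˡ card j)) (cong to e)))

  ∏-reindex : ∀ (σ τ : Carrier → Carrier) → (∀ c → σ (τ c) ≡ c) → (∀ c → τ (σ c) ≡ c) →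
              ∀ f → ∏ (f ∘ σ) ≡ ∏ f
  ∏-reindex σ τ στ τσ f = sym (begin
    ∏ f                                       ≡⟨ Π.∑-permute (f ∘ from) π ⟩
    Π.sum (λ i → f (from (to (σ (from i)))))  ≡⟨ Π.sum-cong-≋ (λ i → cong f (Inverse.strictlyInverseʳ card (σ (from i)))) ⟩
    ∏ (f ∘ σ)                                 ∎)
    where
    liftFin : (Carrier → Carrier) → Fin N → Fin N
    liftFin g = to ∘ g ∘ from
    lift-inverse : ∀ g h → (∀ c → g (h c) ≡ c) → ∀ i → liftFin g (liftFin h i) ≡ i
    lift-inverse g h gh i =
      trans (cong (to ∘ g) (Inverse.strictlyInverseʳ card (h (from i))))
            (trans (cong to (gh (from i))) (Inverse.strictlyInverseˡ card i))
    π : Permutation N N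
    π = permutation (liftFin σ) (liftFin τ) (lift-inverse σ τ στ) (lift-inverse τ σ τσ)

  -- For a ≠ 0, write unit(c) for c with 0 replaced by 1, and pad(c) for a at 0
  -- and 1 elsewhere.  Then unit(a c) pad(c) = a unit(c); taking the product over
  -- all c and reindexing c ↦ a c gives ∏ unit · a = a^N · ∏ unit.
  module NonzeroBase {a : Carrier} (a≢0 : a ≢ 0#) where
    unit : Carrier → Carrier
    unit c with c ≟ 0#
    ... | yes _ = 1#
    ... | no  _ = c

    pad : Carrier → Carrier
    pad c with c ≟ 0#
    ... | yes _ = a
    ... | no  _ = 1#

    unit-nonzero : ∀ c → unit c ≢ 0#
    unit-nonzero c with c ≟ 0#
    ... | yes _   = 1≢0
    ... | no  c≢0 = c≢0

    unit-scale : ∀ c → unit (a * c) * pad c ≡ a * unit c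
    unit-scale c with c ≟ 0#
    unit-scale c | yes refl with (a * 0#) ≟ 0#
    ... | yes _   = trans (*-identityˡ a) (sym (*-identityʳ a))
    ... | no  a0≢0 = ⊥-elim (a0≢0 (zeroʳ a))
    unit-scale c | no c≢0 with (a * c) ≟ 0#
    ... | yes ac≡0 = ⊥-elim (*-nonzero a≢0 c≢0 ac≡0)
    ... | no  _    = *-identityʳ (a * c)

    ∏-pad : ∏ pad ≡ a
    ∏-pad = trans (∏-single pad 0# pad-elsewhere) pad-at-0
      where
      pad-at-0 : pad 0# ≡ a
      pad-at-0 with 0# ≟ 0#
      ... | yes _ = refl
      ... | no 0≢0 = ⊥-elim (0≢0 refl)
      pad-elsewhere : ∀ c → c ≢ 0# → pad c ≡ 1#
      pad-elsewhere c c≢0 with c ≟ 0#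
      ... | yes c≡0 = ⊥-elim (c≢0 c≡0)
      ... | no  _   = refl

    ∏-unit-scaled : ∏ (unit ∘ (a *_)) ≡ ∏ unit
    ∏-unit-scaled = ∏-reindex (a *_) (a ⁻¹ *_) (*-undoes-⁻¹ a≢0) (⁻¹-undoes-* a≢0) unit

    fermat : a ^ᶠ N ≡ a
    fermat = *-cancelˡ (∏-nonzero unit unit-nonzero) (begin
      ∏ unit * a ^ᶠ N                 ≡⟨ *-comm (∏ unit) _ ⟩
      a ^ᶠ N * ∏ unit                 ≡⟨ cong (_* ∏ unit) (sym (∏-const a)) ⟩
      ∏ (λ _ → a) * ∏ unit            ≡⟨ sym (∏-mul (λ _ → a) unit) ⟩
      ∏ (λ c → a * unit c)            ≡⟨ ∏-cong (sym ∘ unit-scale) ⟩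
      ∏ (λ c → unit (a * c) * pad c)  ≡⟨ ∏-mul (unit ∘ (a *_)) pad ⟩
      ∏ (unit ∘ (a *_)) * ∏ pad       ≡⟨ cong₂ _*_ ∏-unit-scaled ∏-pad ⟩
      ∏ unit * a                      ∎)

  sq^-power : ∀ i a → sq^ F i a ≡ a ^ᶠ (2 ^ i)
  sq^-power zero    a = sym (*-identityʳ a)
  sq^-power (suc i) a = begin
    sq^ F i a * sq^ F i a                ≡⟨ cong₂ _*_ (sq^-power i a) (sq^-power i a) ⟩
    a ^ᶠ (2 ^ i) * a ^ᶠ (2 ^ i)          ≡⟨ cong (a ^ᶠ (2 ^ i) *_) (^-congʳ a (sym (Natₚ.+-identityʳ (2 ^ i)))) ⟩
    a ^ᶠ (2 ^ i) * a ^ᶠ (2 ^ i Nat.+ 0)  ≡⟨ sym (^-homo-* a (2 ^ i) _) ⟩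
    a ^ᶠ (2 ^ suc i)                     ∎

  sq^-zero : ∀ i → sq^ F i 0# ≡ 0#
  sq^-zero zero    = refl
  sq^-zero (suc i) = trans (cong (λ z → z * z) (sq^-zero i)) (zeroʳ 0#)

  frobenius-order : ∀ a → sq^ F n a ≡ a
  frobenius-order a with a ≟ 0#
  ... | yes refl = sq^-zero n
  ... | no  a≢0  = trans (sq^-power n a) (NonzeroBase.fermat a≢0)

module Trace {n : ℕ} (F : F2^ n) where
  open F2^ F
  open FieldFacts F
  open Fermat F using (frobenius-order)
  open ≡-Reasoning

  -- a ↦ a^{2^i} is an iterate of the Frobenius map, hence additive; so is Tr.
  sq^-additive : ∀ i a b → sq^ F i (a + b) ≡ sq^ F i a + sq^ F i b
  sq^-additive zero    a b = refl
  sq^-additive (suc i) a b =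
    trans (cong (λ z → z * z) (sq^-additive i a b)) (square-+ (sq^ F i a) (sq^ F i b))

  sq^-square : ∀ i a → sq^ F (suc i) a ≡ sq^ F i (a * a)
  sq^-square zero    a = refl
  sq^-square (suc i) a = cong (λ z → z * z) (sq^-square i a)

  trSum-additive : ∀ k a b → trSum F k (a + b) ≡ trSum F k a + trSum F k b
  trSum-additive zero    a b = sym (+-identityˡ 0#)
  trSum-additive (suc k) a b = begin
    trSum F k (a + b) + sq^ F k (a + b)
      ≡⟨ cong₂ _+_ (trSum-additive k a b) (sq^-additive k a b) ⟩
    (trSum F k a + trSum F k b) + (sq^ F k a + sq^ F k b)
      ≡⟨ +-interchange _ _ _ _ ⟩
    (trSum F k a + sq^ F k a) + (trSum F k b + sq^ F k b) ∎

  Tr-additive : ∀ a b → Tr F (a + b) ≡ Tr F a + Tr F b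
  Tr-additive = trSum-additive n

  trSum-shift : ∀ k a → trSum F k (a * a) + a ≡ trSum F k a + sq^ F k a
  trSum-shift zero    a = refl
  trSum-shift (suc k) a = begin
    (trSum F k (a * a) + sq^ F k (a * a)) + a ≡⟨ +-swapʳ _ _ _ ⟩
    (trSum F k (a * a) + a) + sq^ F k (a * a) ≡⟨ cong₂ _+_ (trSum-shift k a) (sym (sq^-square k a)) ⟩
    (trSum F k a + sq^ F k a) + sq^ F (suc k) a ∎

  -- By Fermat the telescoping sum closes up: Tr(a²) = Tr(a).
  Tr-square : ∀ a → Tr F (a * a) ≡ Tr F a
  Tr-square a = +-cancelʳ a (trans (trSum-shift n a) (cong (Tr F a +_) (frobenius-order a)))

  Tr-artin-schreier : ∀ t → Tr F (t * t + t) ≡ 0#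
  Tr-artin-schreier t = begin
    Tr F (t * t + t)       ≡⟨ Tr-additive (t * t) t ⟩
    Tr F (t * t) + Tr F t  ≡⟨ cong (_+ Tr F t) (Tr-square t) ⟩
    Tr F t + Tr F t        ≡⟨ +-self (Tr F t) ⟩
    0#                     ∎

  -- For β = u + u⁻¹ ≠ 0 and t = u β⁻¹ one has t² + t = β⁻², hence Tr(β⁻¹) = 0.
  Tr-⁻¹-of-u+u⁻¹ : ∀ {u} → u ≢ 0# → u + u ⁻¹ ≢ 0# → Tr F ((u + u ⁻¹) ⁻¹) ≡ 0#
  Tr-⁻¹-of-u+u⁻¹ {u} u≢0 β≢0 = begin
    Tr F b            ≡⟨ sym (Tr-square b) ⟩
    Tr F (b * b)      ≡⟨ cong (Tr F) (sym artin-schreier-form) ⟩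
    Tr F (t * t + t)  ≡⟨ Tr-artin-schreier t ⟩
    0#                ∎
    where
    β b t : Carrier
    β = u + u ⁻¹
    b = β ⁻¹
    t = u * b
    t≡ : t ≡ (u * β) * (b * b)
    t≡ = begin
      u * b              ≡⟨ sym (*-identityʳ t) ⟩
      (u * b) * 1#       ≡⟨ cong (t *_) (sym (inverse β β≢0)) ⟩
      (u * b) * (β * b)  ≡⟨ *-interchange u b β b ⟩
      (u * β) * (b * b)  ∎
    artin-schreier-form : t * t + t ≡ b * b
    artin-schreier-form = begin
      t * t + t                                  ≡⟨ cong₂ _+_ (*-interchange u b u b) t≡ ⟩
      (u * u) * (b * b) + (u * β) * (b * b)      ≡⟨ sym (distribʳ (b * b) (u * u) (u * β)) ⟩
      (u * u + u * β) * (b * b)                  ≡⟨ cong (λ z → (u * u + z) * (b * b)) (*-θ-value u≢0) ⟩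
      (u * u + (u * u + 1#)) * (b * b)           ≡⟨ cong (_* (b * b)) (+-self-cancel (u * u) 1#) ⟩
      1# * (b * b)                               ≡⟨ *-identityˡ (b * b) ⟩
      b * b                                      ∎

module Dynamics {n : ℕ} (F : F2^ n) where
  open F2^ F
  open FieldFacts F
  open Trace F using (Tr-⁻¹-of-u+u⁻¹)

  θ-at-nonzero : ∀ {u} → u ≢ 0# → θ F (just u) ≡ just (u + u ⁻¹)
  θ-at-nonzero {u} u≢0 with u ≟ 0#
  ... | yes u≡0 = ⊥-elim (u≢0 u≡0)
  ... | no  _   = refl

  θ-finite : ∀ {u b} → θ F (just u) ≡ just b → (u ≢ 0#) × (u + u ⁻¹ ≡ b)
  θ-finite {u} θu≡b with u ≟ 0#
  θ-finite {u} ()   | yes _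
  θ-finite {u} refl | no u≢0 = u≢0 , refl

  θ-∞ : ∀ {b} → θ F nothing ≢ just b
  θ-∞ ()

  θ^-∞ : ∀ k → θ^ F k nothing ≡ nothing
  θ^-∞ zero    = refl
  θ^-∞ (suc k) = cong (θ F) (θ^-∞ k)

  θ^-θ : ∀ k z → θ^ F k (θ F z) ≡ θ F (θ^ F k z)
  θ^-θ zero    z = refl
  θ^-θ (suc k) z = cong (θ F) (θ^-θ k z)

  θ-value-Tr-inverse : ∀ {u b} → θ F (just u) ≡ just b → b ≢ 0# → Tr F (b ⁻¹) ≡ 0#
  θ-value-Tr-inverse θu≡b b≢0 with θ-finite θu≡b
  ... | u≢0 , refl = Tr-⁻¹-of-u+u⁻¹ u≢0 b≢0

  periodic-θ^ : ∀ i {z} → Periodic F z → Periodic F (θ^ F i z)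
  periodic-θ^ zero    p = p
  periodic-θ^ (suc i) {z} p with periodic-θ^ i p
  ... | k , k≥1 , returns = k , k≥1 , trans (θ^-θ k (θ^ F i z)) (cong (θ F) returns)

  -- ∞ is fixed by θ, so no finite point returns to itself through 0.
  periodic-nonzero : ∀ {a} → Periodic F (just a) → a ≢ 0#
  periodic-nonzero (zero , () , _)
  periodic-nonzero (suc k , _ , returns) refl = ∞≢finite (begin
      nothing                  ≡⟨ sym (θ^-∞ k) ⟩
      θ^ F k nothing           ≡⟨ cong (θ^ F k) (sym θ-0) ⟩
      θ^ F k (θ F (just 0#))   ≡⟨ θ^-θ k (just 0#) ⟩
      θ^ F (suc k) (just 0#)   ≡⟨ returns ⟩
      just 0#                  ∎)
    where
    open ≡-Reasoning
    ∞≢finite : ∀ {b : Carrier} → nothing ≢ just b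
    ∞≢finite ()
    θ-0 : θ F (just 0#) ≡ nothing
    θ-0 with 0# ≟ 0#
    ... | yes _  = refl
    ... | no 0≢0 = ⊥-elim (0≢0 refl)

  periodic-predecessor : ∀ {a} → Periodic F (just a) →
    Σ Carrier λ u → (θ F (just u) ≡ just a) × Periodic F (just u)
  periodic-predecessor (zero , () , _)
  periodic-predecessor {a} (suc k , k≥1 , returns)
    with θ^ F k (just a) | periodic-θ^ k (suc k , k≥1 , returns) | returns
  ... | nothing | _          | θ∞≡a = ⊥-elim (θ-∞ θ∞≡a)
  ... | just u  | u-periodic | θu≡a = u , θu≡a , u-periodic

  periodic-Tr-inverse : ∀ {a} → Periodic F (just a) → Tr F (a ⁻¹) ≡ 0#
  periodic-Tr-inverse p with periodic-predecessor p
  ... | _ , θu≡a , _ = θ-value-Tr-inverse θu≡a (periodic-nonzero p)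

module Tree {n : ℕ} (F : F2^ n) (x : F2^.Carrier F) (hx : InVB F x) where
  open F2^ F
  open FieldFacts F
  open Trace F using (Tr-additive)
  open Dynamics F
  open ≡-Reasoning

  private
    x-periodic : Periodic F (just x)
    x-periodic = proj₂ hx

    Tr-x≢Tr-x⁻¹ : Tr F x ≢ Tr F (x ⁻¹)
    Tr-x≢Tr-x⁻¹ = proj₂ (proj₁ hx)

    predecessor : Σ Carrier λ u → (θ F (just u) ≡ just x) × Periodic F (just u)
    predecessor = periodic-predecessor x-periodic

  y : Carrier
  y = proj₁ predecessor

  θy≡x : θ F (just y) ≡ just x
  θy≡x = proj₁ (proj₂ predecessor)

  y-periodic : Periodic F (just y)
  y-periodic = proj₂ (proj₂ predecessor)

  y≢0 : y ≢ 0#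
  y≢0 = periodic-nonzero y-periodic

  y-value : y + y ⁻¹ ≡ x
  y-value = proj₂ (θ-finite θy≡x)

  Tr-y≢0 : Tr F y ≢ 0#
  Tr-y≢0 Tr-y≡0 = Tr-x≢Tr-x⁻¹ (begin
    Tr F x                   ≡⟨ cong (Tr F) (sym y-value) ⟩
    Tr F (y + y ⁻¹)          ≡⟨ Tr-additive y (y ⁻¹) ⟩
    Tr F y + Tr F (y ⁻¹)     ≡⟨ cong₂ _+_ Tr-y≡0 (periodic-Tr-inverse y-periodic) ⟩
    0# + 0#                  ≡⟨ +-self 0# ⟩
    0#                       ≡⟨ sym (periodic-Tr-inverse x-periodic) ⟩
    Tr F (x ⁻¹)              ∎)

  -- Tr((y⁻¹)⁻¹) ≠ 0, so y⁻¹ is neither periodic nor a value of θ.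
  Tr-inverse-y⁻¹≢0 : Tr F ((y ⁻¹) ⁻¹) ≢ 0#
  Tr-inverse-y⁻¹≢0 = subst (λ w → Tr F w ≢ 0#) (sym (⁻¹-involutive y≢0)) Tr-y≢0

  child : P1 F
  child = just (y ⁻¹)

  child-maps-to-root : θ F child ≡ just x
  child-maps-to-root = begin
    θ F (just (y ⁻¹))        ≡⟨ θ-at-nonzero (⁻¹-nonzero y≢0) ⟩
    just (y ⁻¹ + (y ⁻¹) ⁻¹)  ≡⟨ cong (λ w → just (y ⁻¹ + w)) (⁻¹-involutive y≢0) ⟩
    just (y ⁻¹ + y)          ≡⟨ cong just (+-comm (y ⁻¹) y) ⟩
    just (y + y ⁻¹)          ≡⟨ cong just y-value ⟩
    just x                   ∎

  child-aperiodic : ¬ Periodic F child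
  child-aperiodic p = Tr-inverse-y⁻¹≢0 (periodic-Tr-inverse p)

  child-is-child : ChildOf F child (just x)
  child-is-child = child-aperiodic , child-maps-to-root

  child-at-level-1 : AtLevel F (just x) child 1
  child-at-level-1 = s≤s z≤n , child-maps-to-root , at-level-0
    where
    at-level-0 : ∀ i → i < 1 → ¬ Periodic F (θ^ F i child)
    at-level-0 zero    _ = child-aperiodic
    at-level-0 (suc i) (s≤s ())

  -- The preimages of x are y and y⁻¹, and y is periodic.
  child-unique : ∀ w → ChildOf F w (just x) → w ≡ child
  child-unique nothing  (_ , ())
  child-unique (just α) (aperiodic , θα≡x) with θ-finite θα≡x
  ... | α≢0 , α-value with same-θ-value y≢0 α≢0 (trans α-value (sym y-value))
  ...   | inj₁ refl = ⊥-elim (aperiodic y-periodic)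
  ...   | inj₂ refl = refl

  child-leaf : ∀ z → θ F z ≢ child
  child-leaf nothing  θ∞≡child = θ-∞ θ∞≡child
  child-leaf (just u) θu≡child = Tr-inverse-y⁻¹≢0 (θ-value-Tr-inverse θu≡child (⁻¹-nonzero y≢0))

  -- A vertex at level k + 2 would map at level 1, i.e. onto the child, in k + 1 steps.
  depth≤1 : ∀ z k → AtLevel F (just x) z k → k ≤ 1
  depth≤1 z zero          _ = z≤n
  depth≤1 z (suc zero)    _ = s≤s z≤n
  depth≤1 z (suc (suc k)) (_ , reaches , aperiodic) =
    ⊥-elim (child-leaf (θ^ F k z) (child-unique (θ^ F (suc k) z) (aperiodic (suc k) (Natₚ.n<1+n (suc k)) , reaches)))

mainTheorem6 : (n : ℕ) → n ≥ 1 → (F : F2^ n) → (x : F2^.Carrier F) →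
    InVB F x →
    (∀ z k → AtLevel F (just x) z k → k ≤ 1) ×
    (Σ (P1 F) λ c → AtLevel F (just x) c 1 × ChildOf F c (just x) ×
    (∀ w → ChildOf F w (just x) → w ≡ c))
mainTheorem6 n _ F x hx = depth≤1 , child , child-at-level-1 , child-is-child , child-unique
  where open Tree F x hx
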